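{- All local PDL-tableaux are finite.
   Context: PDL syntax $\phi ::= \bot \mid p \mid \lnot\phi \mid \phi\land\phi \mid [\alpha]\phi$, $\alpha ::= a \mid \tau? \mid \alpha\cup\beta \mid \alpha;\beta \mid \alpha^\ast$. $\Box(\delta_1\cdots\delta_n,\phi)=[\delta_1]\cdots[\delta_n]\phi$. Unfoldings: $\mathit{Tests}(a)=\emptyset$, $\mathit{Tests}(\tau?)=\{\tau\}$, $\mathit{Tests}(\alpha\cup\beta)=\mathit{Tests}(\alpha;\beta)=\mathit{Tests}(\alpha)\cup\mathit{Tests}(\beta)$, $\mathit{Tests}(\alpha^\ast)=\mathit{Tests}(\alpha)$; for a set $\ell$ of formulas, $P^\ell(a)=\{a\}$, $P^\ell(\tau?)=\{\varepsilon\}$ if $\tau\in\ell$ else $\emptyset$, $P^\ell(\beta\cup\gamma)=P^\ell(\beta)\cup P^\ell(\gamma)$, $P^\ell(\beta;\gamma)=\{\bar\beta\gamma\mid\bar\beta\in P^\ell(\beta)\setminus\{\varepsilon\}\}\cup\{\bar\gamma\mid\bar\gamma\in P^\ell(\gamma),\varepsilon\in P^\ell(\beta)\}$, $P^\ell(\beta^\ast)=\{\varepsilon\}\cup\{\bar\beta\beta^\ast\mid\bar\beta\in P^\ell(\beta)\setminus\{\varepsilon\}\}$; $\mathsf{unfold}_\Box(\alpha,\psi)=\{\{\lnot\tau\mid\tau\in\mathit{Tests}(\alpha)\setminus\ell\}\cup\{\Box(\bar\alpha,\psi)\mid\bar\alpha\in P^\ell(\alpha)\}\mid\ell\subseteq\mathit{Tests}(\alpha)\}$.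 $H_a=\{(\emptyset,a)\}$, $H_{\tau?}=\{(\{\tau\},\varepsilon)\}$, $H_{\alpha\cup\beta}=H_\alpha\cup H_\beta$, $H_{\alpha;\beta}=\{(X,\bar\delta\beta)\mid(X,\bar\delta)\in H_\alpha,\bar\delta\ne\varepsilon\}\cup\{(X\cup Y,\bar\delta)\mid(X,\varepsilon)\in H_\alpha,(Y,\bar\delta)\in H_\beta\}$, $H_{\alpha^\ast}=\{(\emptyset,\varepsilon)\}\cup\{(X,\bar\delta\alpha^\ast)\mid(X,\bar\delta)\in H_\alpha,\bar\delta\ne\varepsilon\}$; $\mathsf{unfold}_\Diamond(\alpha,\psi)=\{X\cup\{\lnot\Box(\bar\delta,\psi)\}\mid(X,\bar\delta)\in H_\alpha\}$. Loading: marked copies $\underline\alpha$ of programs; a loaded formula is $\lnot[\underline{\alpha_1}]\cdots[\underline{\alpha_n}]\phi$ ($n\ge1$, $\phi$ unmarked); $\xi$ ranges over PDL formulas and $[\underline{\alpha_1}]\cdots[\underline{\alpha_k}]\phi$; $\underline{\mathsf{unfold}}_\Diamond(\alpha,\xi)=\{X\cup\{\lnot[\underline{\delta_1}]\cdots[\underline{\delta_n}]\xi\}\mid(X,\delta_1\cdots\delta_n)\in H_\alpha\}$. A sequent (finite set of possibly loaded formulas) is free if it has no loaded formula; basic if all its formulas have the form $\bot,\lnot\bot,p,\lnot p,[a]\phi,\lnot[a]\phi$ ($a$ atomic). Local rules (principal formula not in the context $\Delta$): $(\lnot)$ $\Delta,\lnot\lnot\phi/\Delta,\phi$; $(\land)$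 $\Delta,\phi\land\psi/\Delta,\phi,\psi$; $(\lnot\land)$ $\Delta,\lnot(\phi\land\psi)/\Delta,\lnot\phi\mid\Delta,\lnot\psi$; $(\Box)$ $\Delta,[\alpha]\phi/\{\Delta\cup\Gamma\mid\Gamma\in\mathsf{unfold}_\Box(\alpha,\phi)\}$ ($\alpha$ non-atomic); $(\Diamond)$ $\Delta,\lnot[\alpha]\phi/\{\Delta\cup\Gamma\mid\Gamma\in\mathsf{unfold}_\Diamond(\alpha,\phi)\}$ ($\alpha$ non-atomic); $(\underline\Diamond)$ $\Delta,\lnot[\underline\alpha]\xi/\{\Delta\cup\Gamma\mid\Gamma\in\underline{\mathsf{unfold}}_\Diamond(\alpha,\xi)\}$ ($\alpha$ non-atomic); $(L+)$ $\Delta,\lnot[a][\alpha_1]\cdots[\alpha_n]\phi/\Delta,\lnot[\underline a][\underline{\alpha_1}]\cdots[\underline{\alpha_n}]\phi$ ($\Delta$ free and basic, $n\ge0$ maximal); $(L-)$ $\Delta,\lnot[\underline{\alpha_1}]\cdots[\underline{\alpha_n}]\phi/\Delta,\lnot[\alpha_1]\cdots[\alpha_n]\phi$ ($\Delta$ basic, $n\ge1$); $(L-)$ may not be applied to a node produced by $(L+)$. A local PDL-tableau for $\Gamma$ is a rooted tree whose nodes are labelled by sequents, root labelled $\Gamma$, such that each interior node with its children forms an instance of a local rule (respecting side conditions). -}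

module Defs where

open import Data.Nat using (ℕ)
open import Data.Bool using (Bool; true; false)
open import Data.Unit using (⊤; tt)
open import Data.Empty using (⊥)
open import Data.Product using (Σ; Σ-syntax; _×_; _,_)
open import Data.Sum using (_⊎_)
open import Data.Maybe using (Maybe; just; nothing)
open import Data.List using (List; []; _∷_; _++_; map; foldr)
open import Data.List.Relation.Unary.All using (All)
open import Data.List.Relation.Unary.Any using (Any)
open import Data.List.Membership.Propositional using (_∈_; _∉_)
open import Relation.Binary.PropositionalEquality using (_≡_; _≢_)

infixr 6 _∧f_
infix  7 ~_
infixr 5 _∪p_
infixr 6 _⨾_

mutual
  data Form : Set where
    ⊥f    : Form
    pv    : ℕ → Form
    ~_    : Form → Form
    _∧f_  : Form → Form → Form
    [_]_  : Prog → Form → Form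

  data Prog : Set where
    ap    : ℕ → Prog
    _¿    : Form → Prog
    _∪p_  : Prog → Prog → Prog
    _⨾_   : Prog → Prog → Prog
    _*    : Prog → Prog

Box : List Prog → Form → Form
Box δs φ = foldr [_]_ φ δs

NonAtomic : Prog → Set
NonAtomic (ap _) = ⊥
NonAtomic _      = ⊤

-- "φ is not of the form [β]ψ" (used for maximality of n in (L+))
NotBox : Form → Set
NotBox ([ _ ] _) = ⊥
NotBox _         = ⊤

Tests : Prog → List Form
Tests (ap _)   = []
Tests (τ ¿)    = τ ∷ []
Tests (α ∪p β) = Tests α ++ Tests β
Tests (α ⨾ β)  = Tests α ++ Tests β
Tests (α *)    = Tests α

-- P^ℓ(α) as a predicate on sequences of programs (ε = []).
data P (ℓ : List Form) : Prog → List Prog → Set where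
  P-atom : ∀ {a} → P ℓ (ap a) (ap a ∷ [])
  P-test : ∀ {τ} → τ ∈ ℓ → P ℓ (τ ¿) []
  P-∪ˡ   : ∀ {β γ δs} → P ℓ β δs → P ℓ (β ∪p γ) δs
  P-∪ʳ   : ∀ {β γ δs} → P ℓ γ δs → P ℓ (β ∪p γ) δs
  P-⨾ˡ   : ∀ {β γ δs} → P ℓ β δs → δs ≢ [] → P ℓ (β ⨾ γ) (δs ++ (γ ∷ []))
  P-⨾ʳ   : ∀ {β γ δs} → P ℓ β [] → P ℓ γ δs → P ℓ (β ⨾ γ) δs
  P-*ε   : ∀ {β} → P ℓ (β *) []
  P-*    : ∀ {β δs} → P ℓ β δs → δs ≢ [] → P ℓ (β *) (δs ++ (β * ∷ []))

-- H_α as a predicate on pairs (X, δ̄); the finite set X is given by a list.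
data H : Prog → List Form → List Prog → Set where
  H-atom : ∀ {a} → H (ap a) [] (ap a ∷ [])
  H-test : ∀ {τ} → H (τ ¿) (τ ∷ []) []
  H-∪ˡ   : ∀ {α β X δs} → H α X δs → H (α ∪p β) X δs
  H-∪ʳ   : ∀ {α β X δs} → H β X δs → H (α ∪p β) X δs
  H-⨾ˡ   : ∀ {α β X δs} → H α X δs → δs ≢ [] → H (α ⨾ β) X (δs ++ (β ∷ []))
  H-⨾ʳ   : ∀ {α β X Y δs} → H α X [] → H β Y δs → H (α ⨾ β) (X ++ Y) δs
  H-*ε   : ∀ {α} → H (α *) [] []
  H-*    : ∀ {α X δs} → H α X δs → δs ≢ [] → H (α *) X (δs ++ (α * ∷ []))

-- Possibly loaded formulas.
--   nf φ         : an ordinary (unloaded) PDL formula φ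
--   lf α αs φ    : the loaded formula ¬[α̲][α̲₁]⋯[α̲ₖ]φ  where αs = α₁⋯αₖ, φ unmarked

data LForm : Set where
  nf : Form → LForm
  lf : Prog → List Prog → Form → LForm

loadNeg : List Prog → Form → LForm
loadNeg []       φ = nf (~ φ)
loadNeg (δ ∷ δs) φ = lf δ δs φ

-- Sequents: finite sets of possibly loaded formulas, given by lists
-- (only membership matters).
Seq : Set
Seq = List LForm

_≈_ : Seq → (LForm → Set) → Set
s ≈ S = ∀ χ → (χ ∈ s → S χ) × (S χ → χ ∈ s)

IsFree : LForm → Set
IsFree (nf _)     = ⊤
IsFree (lf _ _ _) = ⊥

Free : Seq → Set
Free Δ = All IsFree Δ

IsBasic : LForm → Set
IsBasic (nf ⊥f)              = ⊤
IsBasic (nf (~ ⊥f))          = ⊤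
IsBasic (nf (pv _))          = ⊤
IsBasic (nf (~ pv _))        = ⊤
IsBasic (nf ([ ap _ ] _))    = ⊤
IsBasic (nf (~ [ ap _ ] _))  = ⊤
IsBasic (lf (ap _) _ _)      = ⊤
IsBasic _                    = ⊥

Basic : Seq → Set
Basic Δ = All IsBasic Δ

-- Each rule instance is given by its principal formula,
-- its side condition on the context Δ, and an indexed family of sets Γᵢ
-- such that the conclusions are exactly the sequents Δ ∪ Γᵢ.

data Rule : Set where
  r¬   : Form → Rule
  r∧   : Form → Form → Rule
  r¬∧  : Form → Form → Rule
  r□   : Prog → Form → Rule
  r◇   : Prog → Form → Rule
  r◇L  : Prog → List Prog → Form → Rule
  rL+  : ℕ → List Prog → Form → Rule
  rL-  : Prog → List Prog → Form → Rule

principal : Rule → LForm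
principal (r¬ φ)        = nf (~ ~ φ)
principal (r∧ φ ψ)      = nf (φ ∧f ψ)
principal (r¬∧ φ ψ)     = nf (~ (φ ∧f ψ))
principal (r□ α φ)      = nf ([ α ] φ)
principal (r◇ α φ)      = nf (~ [ α ] φ)
principal (r◇L α αs φ)  = lf α αs φ
principal (rL+ a αs φ)  = nf (~ [ ap a ] Box αs φ)
principal (rL- α αs φ)  = lf α αs φ

SideCond : Rule → Seq → Set
SideCond (r¬ _)        Δ = ⊤
SideCond (r∧ _ _)      Δ = ⊤
SideCond (r¬∧ _ _)     Δ = ⊤
SideCond (r□ α _)      Δ = NonAtomic α
SideCond (r◇ α _)      Δ = NonAtomic α
SideCond (r◇L α _ _)   Δ = NonAtomic α
SideCond (rL+ _ _ φ)   Δ = Free Δ × Basic Δ × NotBox φ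
SideCond (rL- _ _ _)   Δ = Basic Δ

Idx : Rule → Set
Idx (r¬ _)        = ⊤
Idx (r∧ _ _)      = ⊤
Idx (r¬∧ _ _)     = Bool
Idx (r□ α _)      = Σ[ ℓ ∈ List Form ] (∀ τ → τ ∈ ℓ → τ ∈ Tests α)
Idx (r◇ α _)      = Σ[ X ∈ List Form ] Σ[ δs ∈ List Prog ] H α X δs
Idx (r◇L α _ _)   = Σ[ X ∈ List Form ] Σ[ δs ∈ List Prog ] H α X δs
Idx (rL+ _ _ _)   = ⊤
Idx (rL- _ _ _)   = ⊤

Γ : (r : Rule) → Idx r → LForm → Set
Γ (r¬ φ)       _     χ = χ ≡ nf φ
Γ (r∧ φ ψ)     _     χ = (χ ≡ nf φ) ⊎ (χ ≡ nf ψ)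
Γ (r¬∧ φ ψ)    true  χ = χ ≡ nf (~ φ)
Γ (r¬∧ φ ψ)    false χ = χ ≡ nf (~ ψ)
Γ (r□ α φ)     (ℓ , _) χ =
    (Σ[ τ ∈ Form ] (τ ∈ Tests α × τ ∉ ℓ × χ ≡ nf (~ τ)))
  ⊎ (Σ[ δs ∈ List Prog ] (P ℓ α δs × χ ≡ nf (Box δs φ)))
Γ (r◇ α φ)     (X , δs , _) χ =
    (Σ[ τ ∈ Form ] (τ ∈ X × χ ≡ nf τ)) ⊎ (χ ≡ nf (~ Box δs φ))
Γ (r◇L α αs φ) (X , δs , _) χ =
    (Σ[ τ ∈ Form ] (τ ∈ X × χ ≡ nf τ)) ⊎ (χ ≡ loadNeg (δs ++ αs) φ)
Γ (rL+ a αs φ) _     χ = χ ≡ lf (ap a) αs φ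
Γ (rL- α αs φ) _     χ = χ ≡ nf (~ Box (α ∷ αs) φ)

isL+ : Rule → Bool
isL+ (rL+ _ _ _) = true
isL+ _           = false

isL- : Rule → Bool
isL- (rL- _ _ _) = true
isL- _           = false

Instance : Rule → Seq → List Seq → Set
Instance r s cs = Σ[ Δ ∈ Seq ]
    ( SideCond r Δ
    × principal r ∉ Δ
    × s ≈ (λ χ → χ ∈ Δ ⊎ χ ≡ principal r)
    × All (λ c → Σ[ i ∈ Idx r ] (c ≈ (λ χ → χ ∈ Δ ⊎ Γ r i χ))) cs
    × (∀ (i : Idx r) → Any (λ c → c ≈ (λ χ → χ ∈ Δ ⊎ Γ r i χ)) cs) )

-- Local PDL-tableaux, as (possibly infinite) finitely branching rooted
-- trees presented by their set of nodes, root, labelling, children, and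
-- the rule applied at each interior node.

record LocalTableau : Set₁ where
  field
    Node     : Set
    root     : Node
    label    : Node → Seq
    children : Node → List Node
    ruleAt   : Node → Maybe Rule
    leaf     : ∀ n → ruleAt n ≡ nothing → children n ≡ []
    inst     : ∀ n r → ruleAt n ≡ just r → Instance r (label n) (map label (children n))
    noL+L-   : ∀ n r → ruleAt n ≡ just r → isL+ r ≡ true →
               All (λ c → ∀ r′ → ruleAt c ≡ just r′ → isL- r′ ≡ false) (children n)

data FiniteFrom (T : LocalTableau) : LocalTableau.Node T → Set where
  fin : ∀ {n} → All (FiniteFrom T) (LocalTableau.children T n) → FiniteFrom T n

Finite : LocalTableau → Set
Finite T = FiniteFrom T (LocalTableau.root T)

-- Weigh formulas so that [a]φ and ¬[a]φ with a atomic weigh nothing, the loaded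
-- ¬[a̲]ξ weighs 1, and [α]φ (¬[α]φ) with α non-atomic weighs more than φ (¬φ)
-- together with all tests of α, negated (unnegated). The unfoldings of [α]φ and
-- ¬[α]φ only produce such tests, φ or ¬φ, and boxes headed by an atomic program,
-- so every rule other than (L+) replaces its principal formula by formulas of
-- strictly smaller total weight, and the weight of the label drops along every
-- such edge. A child of an (L+) node is basic and contains a loaded formula, so
-- only (L-) could be applied to it; as that is forbidden, it is a leaf.

{-# OPTIONS --safe #-}
module Submission where

open import Defs
open import Data.Nat using (ℕ; suc; _+_; _≤_; _<_; z≤n; s≤s)
open import Data.Nat.Properties
open import Data.Nat.ListAction using (sum)
open import Data.Nat.ListAction.Properties using (sum-++; sum-↭)
open import Data.Nat.Induction using (<-wellFounded)
open import Induction.WellFounded using (Acc; acc)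
open import Data.Bool using (true; false)
open import Data.Unit using (tt)
open import Data.Product using (Σ-syntax; _×_; _,_; proj₁; proj₂)
open import Data.Sum as Sum using (_⊎_; inj₁; inj₂)
open import Data.Maybe using (just; nothing)
open import Data.List using (List; []; _∷_; _++_; map)
open import Data.List.Properties using (map-++; foldr-++)
open import Data.List.Relation.Unary.All as All using (All; [])
open import Data.List.Relation.Unary.All.Properties using (map⁻)
open import Data.List.Relation.Unary.Any using (here; there)
open import Data.List.Membership.Propositional using (_∈_; _∉_)
open import Data.List.Membership.Propositional.Properties using (∈-++⁺ˡ; ∈-++⁺ʳ; ∈-map⁺; ∈-∃++)
open import Data.List.Relation.Binary.Permutation.Propositional using (_↭_)
open import Data.List.Relation.Binary.Permutation.Propositional.Properties using (shift; ∈-resp-↭) renaming (map⁺ to ↭-map⁺)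
open import Function using (_∘_)
open import Relation.Binary.PropositionalEquality using (_≡_; _≢_; refl; sym; trans; cong; cong₂; subst)
open import Relation.Nullary using (¬_; contradiction)

∈⇒↭∷ : ∀ {A : Set} {x : A} {xs} → x ∈ xs → Σ[ ys ∈ List A ] xs ↭ x ∷ ys
∈⇒↭∷ x∈xs with ys , zs , refl ← ∈-∃++ x∈xs = ys ++ zs , shift _ ys zs

unlessAtomic : Prog → ℕ → ℕ
unlessAtomic (ap _) _ = 0
unlessAtomic _      n = n

unlessAtomic-nonAtomic : ∀ α {n} → NonAtomic α → unlessAtomic α n ≡ n
unlessAtomic-nonAtomic (ap _)   ()
unlessAtomic-nonAtomic (_ ¿)    _ = refl
unlessAtomic-nonAtomic (_ ∪p _) _ = refl
unlessAtomic-nonAtomic (_ ⨾ _)  _ = refl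
unlessAtomic-nonAtomic (_ *)    _ = refl

mutual
  w : Form → ℕ
  w ⊥f        = 0
  w (pv _)    = 0
  w (~ φ)     = w¬ φ
  w (φ ∧f ψ)  = suc (w φ + w ψ)
  w ([ α ] φ) = unlessAtomic α (suc (w φ + wTests¬ α))

  w¬ : Form → ℕ
  w¬ ⊥f        = 0
  w¬ (pv _)    = 0
  w¬ (~ φ)     = suc (w φ)
  w¬ (φ ∧f ψ)  = suc (w¬ φ + w¬ ψ)
  w¬ ([ α ] φ) = unlessAtomic α (suc (w¬ φ + wTests α))

  wTests : Prog → ℕ
  wTests (ap _)   = 0
  wTests (τ ¿)    = w τ
  wTests (α ∪p β) = wTests α + wTests β
  wTests (α ⨾ β)  = wTests α + wTests β
  wTests (α *)    = wTests α

  wTests¬ : Prog → ℕ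
  wTests¬ (ap _)   = 0
  wTests¬ (τ ¿)    = w¬ τ
  wTests¬ (α ∪p β) = wTests¬ α + wTests¬ β
  wTests¬ (α ⨾ β)  = wTests¬ α + wTests¬ β
  wTests¬ (α *)    = wTests¬ α

-- The extra 1 over the unloaded formula pays for (L-).
weight : LForm → ℕ
weight (nf φ)      = w φ
weight (lf α αs φ) = suc (w¬ (Box (α ∷ αs) φ))

‖_‖ : Seq → ℕ
‖ s ‖ = sum (map weight s)

‖‖-++ : ∀ s t → ‖ s ++ t ‖ ≡ ‖ s ‖ + ‖ t ‖
‖‖-++ s t = trans (cong sum (map-++ weight s t)) (sum-++ (map weight s) (map weight t))

‖‖-↭ : ∀ {s t} → s ↭ t → ‖ s ‖ ≡ ‖ t ‖
‖‖-↭ s↭t = sum-↭ (↭-map⁺ weight s↭t)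

‖map‖-++ : ∀ (f : Form → LForm) xs ys → ‖ map f (xs ++ ys) ‖ ≡ ‖ map f xs ‖ + ‖ map f ys ‖
‖map‖-++ f xs ys = trans (cong ‖_‖ (map-++ f xs ys)) (‖‖-++ (map f xs) (map f ys))

_⊆⁺_ : (LForm → Set) → Seq → Set
P ⊆⁺ u = ∀ {χ} → P χ → weight χ ≡ 0 ⊎ χ ∈ u

-- Labels are lists with arbitrary repetitions, so the weight of a set P of
-- formulas is bounded through a list covering its formulas of positive weight.
_≺_ : (LForm → Set) → ℕ → Set
P ≺ k = Σ[ u ∈ Seq ] (P ⊆⁺ u × ‖ u ‖ < k)

conclusion-lighter : ∀ {s c Δ p u} {Γ′ : LForm → Set} →
  s ≈ (λ χ → χ ∈ Δ ⊎ χ ≡ p) → p ∉ Δ → c ≈ (λ χ → χ ∈ Δ ⊎ Γ′ χ) →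
  Γ′ ≺ weight p → (_∈ s) ⊆⁺ u → (_∈ c) ≺ ‖ u ‖
conclusion-lighter {c = c} {Δ} {p} {u} s≈ p∉Δ c≈ (G , Γ′⊆G , G<p) s⊆u
  with s⊆u (proj₂ (s≈ p) (inj₂ refl))
... | inj₁ p≡0 = contradiction (subst (‖ G ‖ <_) p≡0 G<p) n≮0
... | inj₂ p∈u with u⁻ , u↭ ← ∈⇒↭∷ p∈u = G ++ u⁻ , c⊆ , lighter
  where
  Δ⊆u⁻ : (_∈ Δ) ⊆⁺ u⁻
  Δ⊆u⁻ {χ} χ∈Δ = Sum.map₂ drop-p (s⊆u (proj₂ (s≈ χ) (inj₁ χ∈Δ)))
    where
    drop-p : χ ∈ u → χ ∈ u⁻
    drop-p χ∈u with ∈-resp-↭ u↭ χ∈u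
    ... | here refl   = contradiction χ∈Δ p∉Δ
    ... | there χ∈u⁻ = χ∈u⁻

  c⊆ : (_∈ c) ⊆⁺ (G ++ u⁻)
  c⊆ χ∈c with proj₁ (c≈ _) χ∈c
  ... | inj₁ χ∈Δ = Sum.map₂ (∈-++⁺ʳ G) (Δ⊆u⁻ χ∈Δ)
  ... | inj₂ Γ′χ = Sum.map₂ ∈-++⁺ˡ (Γ′⊆G Γ′χ)

  lighter : ‖ G ++ u⁻ ‖ < ‖ u ‖
  lighter = begin-strict
    ‖ G ++ u⁻ ‖        ≡⟨ ‖‖-++ G u⁻ ⟩
    ‖ G ‖ + ‖ u⁻ ‖     <⟨ +-monoˡ-< ‖ u⁻ ‖ G<p ⟩
    weight p + ‖ u⁻ ‖  ≡⟨ sym (‖‖-↭ u↭) ⟩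
    ‖ u ‖              ∎
    where open ≤-Reasoning

data AtomicHead : List Prog → Set where
  ε    : AtomicHead []
  atom : ∀ {a δs} → AtomicHead (ap a ∷ δs)

AtomicHead-++ : ∀ {δs γs} → AtomicHead δs → δs ≢ [] → AtomicHead (δs ++ γs)
AtomicHead-++ ε    δs≢[] = contradiction refl δs≢[]
AtomicHead-++ atom _     = atom

P-atomicHead : ∀ {ℓ α δs} → P ℓ α δs → AtomicHead δs
P-atomicHead P-atom      = atom
P-atomicHead (P-test _)  = ε
P-atomicHead (P-∪ˡ p)    = P-atomicHead p
P-atomicHead (P-∪ʳ p)    = P-atomicHead p
P-atomicHead (P-⨾ˡ p ne) = AtomicHead-++ (P-atomicHead p) ne
P-atomicHead (P-⨾ʳ _ p)  = P-atomicHead p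
P-atomicHead P-*ε        = ε
P-atomicHead (P-* p ne)  = AtomicHead-++ (P-atomicHead p) ne

H-atomicHead : ∀ {α X δs} → H α X δs → AtomicHead δs
H-atomicHead H-atom      = atom
H-atomicHead H-test      = ε
H-atomicHead (H-∪ˡ h)    = H-atomicHead h
H-atomicHead (H-∪ʳ h)    = H-atomicHead h
H-atomicHead (H-⨾ˡ h ne) = AtomicHead-++ (H-atomicHead h) ne
H-atomicHead (H-⨾ʳ _ h)  = H-atomicHead h
H-atomicHead H-*ε        = ε
H-atomicHead (H-* h ne)  = AtomicHead-++ (H-atomicHead h) ne

w-Box-atomicHead : ∀ {δs} φ → AtomicHead δs → δs ≡ [] ⊎ w (Box δs φ) ≡ 0
w-Box-atomicHead φ ε    = inj₁ refl
w-Box-atomicHead φ atom = inj₂ refl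

w¬-Box-atomicHead : ∀ {δs} φ → AtomicHead δs → w¬ (Box δs φ) ≤ w¬ φ
w¬-Box-atomicHead φ ε    = ≤-refl
w¬-Box-atomicHead φ atom = z≤n

weight-loadNeg : ∀ δs αs φ → weight (loadNeg (δs ++ αs) φ) ≤ suc (w¬ (Box δs (Box αs φ)))
weight-loadNeg []      []      φ = n≤1+n _
weight-loadNeg []      (_ ∷ _) φ = ≤-refl
weight-loadNeg (δ ∷ δs) αs     φ = ≤-reflexive (cong (λ ψ → suc (w¬ ([ δ ] ψ))) (foldr-++ [_]_ φ δs αs))

‖negatedTests‖ : ∀ α → ‖ map (nf ∘ ~_) (Tests α) ‖ ≡ wTests¬ α
‖negatedTests‖ (ap _)   = refl
‖negatedTests‖ (τ ¿)    = +-identityʳ _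
‖negatedTests‖ (α ∪p β) =
  trans (‖map‖-++ (nf ∘ ~_) (Tests α) (Tests β)) (cong₂ _+_ (‖negatedTests‖ α) (‖negatedTests‖ β))
‖negatedTests‖ (α ⨾ β)  =
  trans (‖map‖-++ (nf ∘ ~_) (Tests α) (Tests β)) (cong₂ _+_ (‖negatedTests‖ α) (‖negatedTests‖ β))
‖negatedTests‖ (α *)    = ‖negatedTests‖ α

‖H-tests‖ : ∀ {α X δs} → H α X δs → ‖ map nf X ‖ ≤ wTests α
‖H-tests‖ H-atom              = z≤n
‖H-tests‖ H-test              = ≤-reflexive (+-identityʳ _)
‖H-tests‖ (H-∪ˡ h)            = ≤-trans (‖H-tests‖ h) (m≤m+n _ _)
‖H-tests‖ (H-∪ʳ {α = α} h)    = ≤-trans (‖H-tests‖ h) (m≤n+m _ (wTests α))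
‖H-tests‖ (H-⨾ˡ h _)          = ≤-trans (‖H-tests‖ h) (m≤m+n _ _)
‖H-tests‖ (H-⨾ʳ {X = X} {Y} h h′) =
  ≤-trans (≤-reflexive (‖map‖-++ nf X Y)) (+-mono-≤ (‖H-tests‖ h) (‖H-tests‖ h′))
‖H-tests‖ H-*ε                = z≤n
‖H-tests‖ (H-* h _)           = ‖H-tests‖ h

H-unfolding-lighter : ∀ {α X δs} ψ → NonAtomic α → H α X δs →
                      w¬ (Box δs ψ) + ‖ map nf X ‖ < w¬ ([ α ] ψ)
H-unfolding-lighter {α} {X} {δs} ψ nonAtomic h = begin-strict
  w¬ (Box δs ψ) + ‖ map nf X ‖ ≤⟨ +-mono-≤ (w¬-Box-atomicHead ψ (H-atomicHead h)) (‖H-tests‖ h) ⟩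
  w¬ ψ + wTests α              <⟨ n<1+n _ ⟩
  suc (w¬ ψ + wTests α)        ≡⟨ sym (unlessAtomic-nonAtomic α nonAtomic) ⟩
  w¬ ([ α ] ψ)                 ∎
  where open ≤-Reasoning

≺-singleton : ∀ {χ k} → weight χ < k → (_≡ χ) ≺ k
≺-singleton {χ} lt = χ ∷ [] , (λ { refl → inj₂ (here refl) }) , subst (_< _) (sym (+-identityʳ _)) lt

□-unfolding-lighter : ∀ α φ i → NonAtomic α → Γ (r□ α φ) i ≺ w ([ α ] φ)
□-unfolding-lighter α φ i nonAtomic = nf φ ∷ negatedTests , covered , lighter
  where
  negatedTests : Seq
  negatedTests = map (nf ∘ ~_) (Tests α)

  covered : Γ (r□ α φ) i ⊆⁺ (nf φ ∷ negatedTests)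
  covered (inj₁ (_ , τ∈Tests , _ , refl)) = inj₂ (there (∈-map⁺ (nf ∘ ~_) τ∈Tests))
  covered (inj₂ (_ , Pδs , refl)) with w-Box-atomicHead φ (P-atomicHead Pδs)
  ... | inj₁ refl = inj₂ (here refl)
  ... | inj₂ w≡0  = inj₁ w≡0

  lighter : w φ + ‖ negatedTests ‖ < w ([ α ] φ)
  lighter = begin-strict
    w φ + ‖ negatedTests ‖ ≡⟨ cong (w φ +_) (‖negatedTests‖ α) ⟩
    w φ + wTests¬ α        <⟨ n<1+n _ ⟩
    suc (w φ + wTests¬ α)  ≡⟨ sym (unlessAtomic-nonAtomic α nonAtomic) ⟩
    w ([ α ] φ)            ∎
    where open ≤-Reasoning

◇-unfolding-lighter : ∀ α φ i → NonAtomic α → Γ (r◇ α φ) i ≺ w¬ ([ α ] φ)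
◇-unfolding-lighter α φ (X , δs , h) nonAtomic =
  nf (~ Box δs φ) ∷ map nf X , covered , H-unfolding-lighter φ nonAtomic h
  where
  covered : Γ (r◇ α φ) (X , δs , h) ⊆⁺ (nf (~ Box δs φ) ∷ map nf X)
  covered (inj₁ (_ , τ∈X , refl)) = inj₂ (there (∈-map⁺ nf τ∈X))
  covered (inj₂ refl)             = inj₂ (here refl)

◇L-unfolding-lighter : ∀ α αs φ i → NonAtomic α → Γ (r◇L α αs φ) i ≺ weight (lf α αs φ)
◇L-unfolding-lighter α αs φ (X , δs , h) nonAtomic = loadNeg (δs ++ αs) φ ∷ map nf X , covered , lighter
  where
  covered : Γ (r◇L α αs φ) (X , δs , h) ⊆⁺ (loadNeg (δs ++ αs) φ ∷ map nf X)
  covered (inj₁ (_ , τ∈X , refl)) = inj₂ (there (∈-map⁺ nf τ∈X))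
  covered (inj₂ refl)             = inj₂ (here refl)

  lighter : weight (loadNeg (δs ++ αs) φ) + ‖ map nf X ‖ < weight (lf α αs φ)
  lighter = begin-strict
    weight (loadNeg (δs ++ αs) φ) + ‖ map nf X ‖ ≤⟨ +-monoˡ-≤ _ (weight-loadNeg δs αs φ) ⟩
    suc (w¬ (Box δs (Box αs φ)) + ‖ map nf X ‖)   <⟨ s≤s (H-unfolding-lighter (Box αs φ) nonAtomic h) ⟩
    weight (lf α αs φ)                            ∎
    where open ≤-Reasoning

Γ-lighter : ∀ r {Δ} → SideCond r Δ → isL+ r ≡ false → (i : Idx r) → Γ r i ≺ weight (principal r)
Γ-lighter (r¬ φ)       _         _ _     = ≺-singleton (n<1+n _)
Γ-lighter (r∧ φ ψ)     _         _ _     =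
  nf φ ∷ nf ψ ∷ [] , (λ { (inj₁ refl) → inj₂ (here refl) ; (inj₂ refl) → inj₂ (there (here refl)) }) ,
  s≤s (≤-reflexive (cong (w φ +_) (+-identityʳ _)))
Γ-lighter (r¬∧ φ ψ)    _         _ true  = ≺-singleton (s≤s (m≤m+n _ _))
Γ-lighter (r¬∧ φ ψ)    _         _ false = ≺-singleton (s≤s (m≤n+m _ _))
Γ-lighter (r□ α φ)     nonAtomic _ i     = □-unfolding-lighter α φ i nonAtomic
Γ-lighter (r◇ α φ)     nonAtomic _ i     = ◇-unfolding-lighter α φ i nonAtomic
Γ-lighter (r◇L α αs φ) nonAtomic _ i     = ◇L-unfolding-lighter α αs φ i nonAtomic
Γ-lighter (rL- α αs φ) _         _ _     = ≺-singleton (n<1+n _)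

Instance-lighter : ∀ {r s cs u} → isL+ r ≡ false → Instance r s cs → (_∈ s) ⊆⁺ u →
                   All (λ c → (_∈ c) ≺ ‖ u ‖) cs
Instance-lighter {r} notL+ (_ , side , p∉Δ , s≈ , conclusions , _) s⊆u =
  All.map (λ (i , c≈) → conclusion-lighter s≈ p∉Δ c≈ (Γ-lighter r side notL+ i) s⊆u) conclusions

basic-principal⇒free : ∀ r {Δ} → SideCond r Δ → isL- r ≡ false → IsBasic (principal r) →
                       IsFree (principal r) × Free Δ
-- In the omitted cases the principal formula is not basic, or r is (L-).
basic-principal⇒free (rL+ _ _ _)      (free , _) _ _ = tt , free
basic-principal⇒free (r□ (ap _) _)    () _ _
basic-principal⇒free (r◇ (ap _) _)    () _ _
basic-principal⇒free (r◇L (ap _) _ _) () _ _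

basic-loaded⇒¬Instance : ∀ {r s cs} → Basic s → ¬ Free s → isL- r ≡ false → ¬ Instance r s cs
basic-loaded⇒¬Instance {r} {s} basic loaded notL- (_ , side , _ , s≈ , _) = loaded (All.tabulate free)
  where
  principal∈s : principal r ∈ s
  principal∈s = proj₂ (s≈ _) (inj₂ refl)

  free : ∀ {χ} → χ ∈ s → IsFree χ
  free χ∈s with basic-principal⇒free r side notL- (All.lookup basic principal∈s)
  ... | principal-free , Δ-free with proj₁ (s≈ _) χ∈s
  ...   | inj₁ χ∈Δ = All.lookup Δ-free χ∈Δ
  ...   | inj₂ refl = principal-free

L+-conclusions-basic-loaded : ∀ {a αs φ s cs} → Instance (rL+ a αs φ) s cs → All (λ c → Basic c × ¬ Free c) cs
L+-conclusions-basic-loaded {a} {αs} {φ} (Δ , (_ , Δ-basic , _) , _ , _ , conclusions , _) =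
  All.map (λ (_ , c≈) → All.tabulate (basic c≈) , λ free → All.lookup free (proj₂ (c≈ _) (inj₂ refl)))
          conclusions
  where
  basic : ∀ {c χ} → c ≈ (λ χ → χ ∈ Δ ⊎ χ ≡ lf (ap a) αs φ) → χ ∈ c → IsBasic χ
  basic c≈ χ∈c with proj₁ (c≈ _) χ∈c
  ... | inj₁ χ∈Δ = All.lookup Δ-basic χ∈Δ
  ... | inj₂ refl = tt

module _ (T : LocalTableau) where
  open LocalTableau T

  leaf⇒finiteFrom : ∀ {n} → ruleAt n ≡ nothing → FiniteFrom T n
  leaf⇒finiteFrom {n} noRule = fin (subst (All (FiniteFrom T)) (sym (leaf n noRule)) [])

  L+-children-finite : ∀ {n r} → ruleAt n ≡ just r → isL+ r ≡ true → All (FiniteFrom T) (children n)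
  L+-children-finite {n} {rL+ _ _ _} rule _ =
    All.zipWith stuck-finite (map⁻ (L+-conclusions-basic-loaded (inst n _ rule)) , noL+L- n _ rule refl)
    where
    stuck-finite : ∀ {c} → (Basic (label c) × ¬ Free (label c)) × (∀ r → ruleAt c ≡ just r → isL- r ≡ false) →
                   FiniteFrom T c
    stuck-finite {c} ((basic , loaded) , notL-) with ruleAt c in rule′
    ... | nothing = leaf⇒finiteFrom rule′
    ... | just r  = contradiction (inst c r rule′) (basic-loaded⇒¬Instance basic loaded (notL- r refl))

  bounded⇒finiteFrom : ∀ {n} u → (_∈ label n) ⊆⁺ u → Acc _<_ ‖ u ‖ → FiniteFrom T n
  bounded⇒finiteFrom {n} u n⊆u (acc smaller) with ruleAt n in rule
  ... | nothing = leaf⇒finiteFrom rule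
  ... | just r with isL+ r in isL+r
  ...   | true  = fin (L+-children-finite rule isL+r)
  ...   | false = fin (All.map (λ (u′ , c⊆u′ , u′<u) → bounded⇒finiteFrom u′ c⊆u′ (smaller u′<u))
                               (map⁻ (Instance-lighter isL+r (inst n r rule) n⊆u)))

lemma3p39 : (T : LocalTableau) → Finite T
lemma3p39 T = bounded⇒finiteFrom T (label root) inj₂ (<-wellFounded _)
  where open LocalTableau T
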